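{- Let $\lambda\in\mathbb{C}$ with $\lambda\neq 1$, let $r,k\in\mathbb{Z}$ and $n\in\mathbb{Z}$ with $n\geq 2$. Then \[ (n+1)T_{n}^{(r,k)}(x|\lambda)+n\left(r-\tfrac{1}{2}-x\right)T_{n-1}^{(r,k)}(x|\lambda)+\sum_{l=0}^{n-2}\binom{n}{l}B_{n-l} T_{l}^{(r,k)}(x|\lambda) =-\frac{r\lambda n}{1-\lambda}T_{n-1}^{(r+1,k)}(x|\lambda)+\sum_{l=0}^{n}\binom{n}{l}B_{n-l} T_{l}^{(r,k-1)}(x|\lambda). \]
   Context: For $k\in\mathbb{Z}$, $Li_k(x)=\sum_{n\ge1}x^n/n^k$. For $r,k\in\mathbb{Z}$ the polynomials $T_n^{(r,k)}(x|\lambda)$ are defined by $\left(\frac{1-\lambda}{e^t-\lambda}\right)^r\frac{Li_{k}(1-e^{ -t})}{1-e^{ -t}}e^{xt}=\sum_{n\ge0}T_n^{(r,k)}(x|\lambda)\frac{t^n}{n!}$ (as formal power series in $t$). $B_l$ denotes the ordinary Bernoulli numbers, $\frac{t}{e^t-1}=\sum_{l\ge0}B_l\frac{t^l}{l!}$. -}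

module Defs where

open import Level using (Level; _⊔_) renaming (suc to lsuc)
open import Data.Nat using (ℕ; zero; suc)
open import Data.Nat.Combinatorics using (_C_)
open import Data.Integer using (ℤ; +_; -[1+_])
open import Algebra.Bundles using (CommutativeRing)
open import Relation.Nullary using (¬_)

module RingOps {c ℓ : Level} (R : CommutativeRing c ℓ) where
  open CommutativeRing R

  ι : ℕ → Carrier
  ι zero = 0#
  ι (suc n) = 1# + ι n

  ιℤ : ℤ → Carrier
  ιℤ (+ n) = ι n
  ιℤ -[1+ n ] = - ι (suc n)

  _^_ : Carrier → ℕ → Carrier
  x ^ zero = 1#
  x ^ suc n = x * (x ^ n)

  Σ≤ : ℕ → (ℕ → Carrier) → Carrier
  Σ≤ zero f = f 0
  Σ≤ (suc n) f = Σ≤ n f + f (suc n)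

-- A field of characteristic zero, presented as a commutative ring with a
-- (total) inverse operation which is a genuine inverse on nonzero elements,
-- and in which n·1 ≠ 0 for all n ≥ 1.  (ℂ is an instance.)
record CharZeroField (c ℓ : Level) : Set (lsuc (c ⊔ ℓ)) where
  field
    cring : CommutativeRing c ℓ
  open CommutativeRing cring public
  open RingOps cring public
  field
    _⁻¹ : Carrier → Carrier
    ⁻¹-inverse : ∀ x → ¬ (x ≈ 0#) → (x * (x ⁻¹)) ≈ 1#
    char-zero : ∀ n → ¬ (ι (suc n) ≈ 0#)

module Series {c ℓ : Level} (F : CharZeroField c ℓ) where
  open CharZeroField F

  -- A formal power series A(t) = Σ a_n t^n / n! is represented by its
  -- sequence of "exponential" coefficients a : ℕ → F.
  EGF : Set c
  EGF = ℕ → Carrier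

  _⊛_ : EGF → EGF → EGF
  (a ⊛ b) n = Σ≤ n (λ l → ι (n C l) * (a l * b (n Data.Nat.∸ l)))

  one : EGF
  one zero = 1#
  one (suc n) = 0#

  pow : EGF → ℕ → EGF
  pow a zero = one
  pow a (suc j) = a ⊛ pow a j

  -- For d with d 0 = 0, the formal inverse of 1 - d is the geometric series
  -- Σ_j d^j; its coefficient of t^n/n! only involves j ≤ n.
  inv1- : EGF → EGF
  inv1- d n = Σ≤ n (λ j → pow d j n)

  expS : Carrier → EGF
  expS x n = x ^ n

  -- Bernoulli numbers:  t/(e^t - 1) = 1/(1 - d) with
  -- (e^t - 1)/t = Σ t^n/(n+1)! ,  i.e.  d = 1 - (e^t-1)/t,  d_0 = 0, d_n = -1/(n+1).
  bernD : EGF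
  bernD zero = 0#
  bernD (suc n) = - (ι (suc (suc n)) ⁻¹)

  B : ℕ → Carrier
  B = inv1- bernD

  -- (1-λ)/(e^t - λ) = 1/(1 - d) with d = (1 - e^t)/(1 - λ)
  ratD : Carrier → EGF
  ratD λ' zero = 0#
  ratD λ' (suc n) = - ((1# + - λ') ⁻¹)

  -- (e^t - λ)/(1 - λ)
  ratH : Carrier → EGF
  ratH λ' zero = 1#
  ratH λ' (suc n) = (1# + - λ') ⁻¹

  -- ((1-λ)/(e^t-λ))^r  for r ∈ ℤ
  ratPow : Carrier → ℤ → EGF
  ratPow λ' (+ r) = pow (inv1- (ratD λ')) r
  ratPow λ' -[1+ r ] = pow (ratH λ') (suc r)

  mpow : ℕ → ℤ → Carrier
  mpow m (+ a) = ((ι m) ^ a) ⁻¹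
  mpow m -[1+ a ] = (ι m) ^ (suc a)

  oneMinusExpNeg : EGF
  oneMinusExpNeg zero = 0#
  oneMinusExpNeg (suc n) = - ((- 1#) ^ suc n)

  -- Li_k(1-e^{-t})/(1-e^{-t}) = Σ_{m≥1} m^{-k} (1-e^{-t})^{m-1}
  liS : ℤ → EGF
  liS k n = Σ≤ n (λ j → mpow (suc j) k * pow oneMinusExpNeg j n)

  T : ℤ → ℤ → Carrier → Carrier → ℕ → Carrier
  T r k λ' x = (ratPow λ' r ⊛ liS k) ⊛ expS x

-- In the ring of exponential generating functions, where d/dt shifts the
-- coefficients, T = P · L · eˣᵗ with P = ((1-λ)/(eᵗ-λ))^r and
-- L = Li_k(1-e⁻ᵗ)/(1-e⁻ᵗ).  The rational factor satisfies
-- P′ = -r P - κ r P^{(r+1)} with κ = λ/(1-λ), and since (eᵗ-1) d/dt acts on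
-- u = 1-e⁻ᵗ as the Euler operator u d/du, (eᵗ-1) L′ = L^{(k-1)} - L.  Hence
-- (eᵗ-1) (T′ + (r-x) T + κ r T^{(r+1,k)}) = T^{(r,k-1)} - T.  Multiplying by
-- t/(eᵗ-1) = Σ Bₗ tˡ/l! and comparing the coefficients of tⁿ/n!, using
-- B₀ = 1 and B₁ = -1/2, gives the recurrence.
module Submission where

open import Level using (Level)
open import Data.Nat as ℕ using (ℕ; zero; suc; _≤_; _<_; z≤n; s≤s; _∸_)
import Data.Nat.Properties as ℕ
open import Data.Nat.Combinatorics
  using (_C_; nCk+nC[k+1]≡[n+1]C[k+1]; k>n⇒nCk≡0; nCk≡nC[n∸k]; nC1≡n; nCn≡1)
open import Data.Integer as ℤ using (ℤ; +_; -[1+_]; _⊖_)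
import Data.Integer.Properties as ℤ
open import Data.Sign as Sign using (Sign)
open import Data.Maybe using (Maybe; just; nothing)
open import Data.Sum using (inj₁; inj₂)
open import Data.Product using (_,_)
open import Relation.Nullary using (¬_; yes; no)
open import Relation.Binary.PropositionalEquality as ≡ using (_≡_)
open import Algebra.Bundles using (CommutativeRing)
import Algebra.Construct.Pointwise
import Algebra.Solver.Ring
import Algebra.Solver.Ring.AlmostCommutativeRing as ACR
import Algebra.Properties.Ring
import Algebra.Properties.CommutativeSemigroup as CommutativeSemigroupProperties
import Algebra.Properties.Semiring.Mult.TCOptimised as Mult
import Relation.Binary.Reasoning.Setoid as SetoidReasoning

open import Defs

[1+n]Cn≡1+n : ∀ n → suc n C n ≡ suc n
[1+n]Cn≡1+n n = begin
  suc n C n             ≡⟨ nCk≡nC[n∸k] (ℕ.n≤1+n n) ⟩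
  suc n C (suc n ∸ n)   ≡⟨ ≡.cong (suc n C_) (ℕ.m+n∸n≡m 1 n) ⟩
  suc n C 1             ≡⟨ nC1≡n (suc n) ⟩
  suc n                 ∎
  where open ≡.≡-Reasoning

module CommutativeRingFacts {c ℓ : Level} (R : CommutativeRing c ℓ) where
  open CommutativeRing R
  open RingOps R
  open Algebra.Properties.Ring ring public
  open Mult semiring using (_×_; 1+×; ×-homo-+; ×1-homo-*)
  open CommutativeSemigroupProperties +-commutativeSemigroup using () renaming (interchange to +-interchange)
  open CommutativeSemigroupProperties *-commutativeSemigroup using () renaming (interchange to *-interchange)
  open SetoidReasoning setoid

  ι-+ : ∀ m n → ι (m ℕ.+ n) ≈ ι m + ι n
  ι-+ zero    n = sym (+-identityˡ _)
  ι-+ (suc m) n = trans (+-congˡ (ι-+ m n)) (sym (+-assoc _ _ _))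

  1#^n≈1# : ∀ n → 1# ^ n ≈ 1#
  1#^n≈1# zero    = refl
  1#^n≈1# (suc n) = trans (*-identityˡ _) (1#^n≈1# n)

  -- Coefficient map of the ring solver.  It uses the type-checking optimised
  -- multiple _×_, so that the solver constants 0, 1 and -1 denote 0#, 1# and
  -- - 1# on the nose.
  ⟦_⟧ℤ : ℤ → Carrier
  ⟦ + n      ⟧ℤ = n × 1#
  ⟦ -[1+ n ] ⟧ℤ = - (suc n × 1#)

  private
    sign : Sign → Carrier
    sign Sign.+ = 1#
    sign Sign.- = - 1#

    sign-* : ∀ s t → sign (s Sign.* t) ≈ sign s * sign t
    sign-* Sign.+ t      = sym (*-identityˡ _)
    sign-* Sign.- Sign.+ = sym (*-identityʳ _)
    sign-* Sign.- Sign.- = sym (trans (-1*x≈-x _) (-‿involutive _))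

    ⟦◃⟧ : ∀ s n → ⟦ s ℤ.◃ n ⟧ℤ ≈ sign s * (n × 1#)
    ⟦◃⟧ s      zero    = sym (zeroʳ _)
    ⟦◃⟧ Sign.+ (suc n) = sym (*-identityˡ _)
    ⟦◃⟧ Sign.- (suc n) = sym (-1*x≈-x _)

    ⟦⟧ℤ-sign : ∀ i → ⟦ i ⟧ℤ ≈ sign (ℤ.sign i) * (ℤ.∣ i ∣ × 1#)
    ⟦⟧ℤ-sign (+ n)    = sym (*-identityˡ _)
    ⟦⟧ℤ-sign -[1+ n ] = sym (-1*x≈-x _)

    ⟦⊖⟧ : ∀ m n → ⟦ m ⊖ n ⟧ℤ ≈ m × 1# - n × 1#
    ⟦⊖⟧ m       zero    = sym (trans (+-congˡ -0#≈0#) (+-identityʳ _))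
    ⟦⊖⟧ zero    (suc n) = sym (+-identityˡ _)
    ⟦⊖⟧ (suc m) (suc n) = begin
      ⟦ suc m ⊖ suc n ⟧ℤ               ≡⟨ ≡.cong ⟦_⟧ℤ (ℤ.[1+m]⊖[1+n]≡m⊖n m n) ⟩
      ⟦ m ⊖ n ⟧ℤ                       ≈⟨ ⟦⊖⟧ m n ⟩
      m × 1# - n × 1#                  ≈⟨ cancel 1# (m × 1#) (n × 1#) ⟨
      (1# + m × 1#) - (1# + n × 1#)    ≈⟨ +-cong (1+× m 1#) (-‿cong (1+× n 1#)) ⟨
      suc m × 1# - suc n × 1#          ∎
      where
      cancel : ∀ a x y → (a + x) - (a + y) ≈ x - y
      cancel a x y = begin
        (a + x) - (a + y)     ≈⟨ +-congˡ (-‿+-comm a y) ⟨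
        (a + x) + (- a - y)   ≈⟨ +-interchange a x (- a) (- y) ⟩
        (a - a) + (x - y)     ≈⟨ +-congʳ (-‿inverseʳ a) ⟩
        0# + (x - y)          ≈⟨ +-identityˡ _ ⟩
        x - y                 ∎

  ⟦⟧ℤ-+ : ∀ i j → ⟦ i ℤ.+ j ⟧ℤ ≈ ⟦ i ⟧ℤ + ⟦ j ⟧ℤ
  ⟦⟧ℤ-+ (+ m)    (+ n)    = ×-homo-+ 1# m n
  ⟦⟧ℤ-+ (+ m)    -[1+ n ] = ⟦⊖⟧ m (suc n)
  ⟦⟧ℤ-+ -[1+ m ] (+ n)    = trans (⟦⊖⟧ n (suc m)) (+-comm _ _)
  ⟦⟧ℤ-+ -[1+ m ] -[1+ n ] = begin
    - (suc (suc (m ℕ.+ n)) × 1#)    ≡⟨ ≡.cong (λ k → - (suc k × 1#)) (ℕ.+-suc m n) ⟨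
    - ((suc m ℕ.+ suc n) × 1#)      ≈⟨ -‿cong (×-homo-+ 1# (suc m) (suc n)) ⟩
    - (suc m × 1# + suc n × 1#)     ≈⟨ -‿+-comm _ _ ⟨
    - (suc m × 1#) - (suc n × 1#)   ∎

  ⟦⟧ℤ-* : ∀ i j → ⟦ i ℤ.* j ⟧ℤ ≈ ⟦ i ⟧ℤ * ⟦ j ⟧ℤ
  ⟦⟧ℤ-* i j = begin
    ⟦ sᵢ Sign.* sⱼ ℤ.◃ ∣i∣ ℕ.* ∣j∣ ⟧ℤ
      ≈⟨ ⟦◃⟧ (sᵢ Sign.* sⱼ) (∣i∣ ℕ.* ∣j∣) ⟩
    sign (sᵢ Sign.* sⱼ) * ((∣i∣ ℕ.* ∣j∣) × 1#)
      ≈⟨ *-cong (sign-* sᵢ sⱼ) (×1-homo-* ∣i∣ ∣j∣) ⟩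
    (sign sᵢ * sign sⱼ) * ((∣i∣ × 1#) * (∣j∣ × 1#))
      ≈⟨ *-interchange _ _ _ _ ⟩
    (sign sᵢ * (∣i∣ × 1#)) * (sign sⱼ * (∣j∣ × 1#))
      ≈⟨ *-cong (⟦⟧ℤ-sign i) (⟦⟧ℤ-sign j) ⟨
    ⟦ i ⟧ℤ * ⟦ j ⟧ℤ
      ∎
    where
    sᵢ = ℤ.sign i
    sⱼ = ℤ.sign j
    ∣i∣ = ℤ.∣ i ∣
    ∣j∣ = ℤ.∣ j ∣

  ⟦⟧ℤ-neg : ∀ i → ⟦ ℤ.- i ⟧ℤ ≈ - ⟦ i ⟧ℤ
  ⟦⟧ℤ-neg (+ zero)  = sym -0#≈0#
  ⟦⟧ℤ-neg (+ suc n) = refl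
  ⟦⟧ℤ-neg -[1+ n ]  = sym (-‿involutive _)

  ℤ-homomorphism : ACR._-Raw-AlmostCommutative⟶_ ℤ.+-*-rawRing (ACR.fromCommutativeRing R)
  ℤ-homomorphism = record
    { ⟦_⟧    = ⟦_⟧ℤ
    ; +-homo = ⟦⟧ℤ-+
    ; *-homo = ⟦⟧ℤ-*
    ; -‿homo = ⟦⟧ℤ-neg
    ; 0-homo = refl
    ; 1-homo = refl
    }

  private
    ⟦⟧ℤ-≟ : ∀ i j → Maybe (⟦ i ⟧ℤ ≈ ⟦ j ⟧ℤ)
    ⟦⟧ℤ-≟ i j with i ℤ.≟ j
    ... | yes ≡.refl = just refl
    ... | no _       = nothing

  module Solver = Algebra.Solver.Ring ℤ.+-*-rawRing (ACR.fromCommutativeRing R) ℤ-homomorphism ⟦⟧ℤ-≟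

  Σ≤-cong : ∀ n {f g : ℕ → Carrier} → (∀ l → l ≤ n → f l ≈ g l) → Σ≤ n f ≈ Σ≤ n g
  Σ≤-cong zero    f≈g = f≈g 0 z≤n
  Σ≤-cong (suc n) f≈g =
    +-cong (Σ≤-cong n (λ l l≤n → f≈g l (ℕ.m≤n⇒m≤1+n l≤n))) (f≈g (suc n) ℕ.≤-refl)

  Σ≤-distrib-+ : ∀ n (f g : ℕ → Carrier) → Σ≤ n (λ l → f l + g l) ≈ Σ≤ n f + Σ≤ n g
  Σ≤-distrib-+ zero    f g = refl
  Σ≤-distrib-+ (suc n) f g = trans (+-congʳ (Σ≤-distrib-+ n f g)) (+-interchange _ _ _ _)

  *-distribˡ-Σ≤ : ∀ n a (f : ℕ → Carrier) → a * Σ≤ n f ≈ Σ≤ n (λ l → a * f l)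
  *-distribˡ-Σ≤ zero    a f = refl
  *-distribˡ-Σ≤ (suc n) a f = trans (distribˡ _ _ _) (+-congʳ (*-distribˡ-Σ≤ n a f))

  Σ≤-zero : ∀ n (f : ℕ → Carrier) → (∀ l → l ≤ n → f l ≈ 0#) → Σ≤ n f ≈ 0#
  Σ≤-zero n f f≈0 = trans (Σ≤-cong n f≈0) (Σ≤-const n)
    where
    Σ≤-const : ∀ n → Σ≤ n (λ _ → 0#) ≈ 0#
    Σ≤-const zero    = refl
    Σ≤-const (suc n) = trans (+-identityʳ _) (Σ≤-const n)

  Σ≤-split-head : ∀ n (f : ℕ → Carrier) → Σ≤ (suc n) f ≈ f 0 + Σ≤ n (λ l → f (suc l))
  Σ≤-split-head zero    f = refl
  Σ≤-split-head (suc n) f = trans (+-congʳ (Σ≤-split-head n f)) (+-assoc _ _ _)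

  Σ≤-extend : ∀ {n} N (f : ℕ → Carrier) → n ≤ N →
              (∀ l → n < l → l ≤ N → f l ≈ 0#) → Σ≤ N f ≈ Σ≤ n f
  Σ≤-extend zero f z≤n _ = refl
  Σ≤-extend {n} (suc N) f n≤1+N tail≈0 with ℕ.m≤n⇒m<n∨m≡n n≤1+N
  ... | inj₂ ≡.refl    = refl
  ... | inj₁ (s≤s n≤N) = begin
    Σ≤ N f + f (suc N)
      ≈⟨ +-cong (Σ≤-extend N f n≤N (λ l n<l l≤N → tail≈0 l n<l (ℕ.m≤n⇒m≤1+n l≤N)))
                (tail≈0 (suc N) (s≤s n≤N) ℕ.≤-refl) ⟩
    Σ≤ n f + 0#
      ≈⟨ +-identityʳ _ ⟩
    Σ≤ n f
      ∎

  Σ≤-telescope : ∀ N (f : ℕ → Carrier) → Σ≤ N (λ j → f j - f (suc j)) ≈ f 0 - f (suc N)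
  Σ≤-telescope zero    f = refl
  Σ≤-telescope (suc N) f = trans (+-congʳ (Σ≤-telescope N f)) (cancel _ _ _)
    where
    open Solver using (solve; _:=_; _:-_; _:+_)
    cancel : ∀ x y z → (x - y) + (y - z) ≈ x - z
    cancel = solve 3 (λ x y z → (x :- y) :+ (y :- z) := x :- z) refl

module PowerSeriesRing {c ℓ : Level} (F : CharZeroField c ℓ) where
  open CharZeroField F
  open Series F
  open CommutativeRingFacts cring
  open SetoidReasoning setoid

  infix  4 _≋_
  infixl 6 _⊞_
  infix  8 ⊟_

  _≋_ : EGF → EGF → Set ℓ
  a ≋ b = ∀ n → a n ≈ b n

  _⊞_ : EGF → EGF → EGF
  (a ⊞ b) n = a n + b n

  ⊟_ : EGF → EGF
  (⊟ a) n = - a n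

  𝟘 : EGF
  𝟘 n = 0#

  -- On exponential generating functions the derivative is the shift.
  ∂ : EGF → EGF
  ∂ a n = a (suc n)

  ≋-refl : ∀ {a} → a ≋ a
  ≋-refl n = refl

  ≋-sym : ∀ {a b} → a ≋ b → b ≋ a
  ≋-sym a≋b n = sym (a≋b n)

  ≋-trans : ∀ {a b e} → a ≋ b → b ≋ e → a ≋ e
  ≋-trans a≋b b≋e n = trans (a≋b n) (b≋e n)

  ⊞-cong : ∀ {a a′ b b′} → a ≋ a′ → b ≋ b′ → a ⊞ b ≋ a′ ⊞ b′
  ⊞-cong a≋a′ b≋b′ n = +-cong (a≋a′ n) (b≋b′ n)

  ⊞-congˡ : ∀ a {b b′} → b ≋ b′ → a ⊞ b ≋ a ⊞ b′
  ⊞-congˡ a b≋b′ n = +-congˡ (b≋b′ n)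

  ⊞-congʳ : ∀ b {a a′} → a ≋ a′ → a ⊞ b ≋ a′ ⊞ b
  ⊞-congʳ b a≋a′ n = +-congʳ (a≋a′ n)

  ⊟-cong : ∀ {a a′} → a ≋ a′ → ⊟ a ≋ ⊟ a′
  ⊟-cong a≋a′ n = -‿cong (a≋a′ n)

  ⊛-cong : ∀ {a a′ b b′} → a ≋ a′ → b ≋ b′ → a ⊛ b ≋ a′ ⊛ b′
  ⊛-cong a≋a′ b≋b′ n = Σ≤-cong n (λ l _ → *-congˡ (*-cong (a≋a′ l) (b≋b′ (n ∸ l))))

  ⊛-congˡ : ∀ a {b b′} → b ≋ b′ → a ⊛ b ≋ a ⊛ b′
  ⊛-congˡ a = ⊛-cong {a = a} ≋-refl

  ⊛-congʳ : ∀ b {a a′} → a ≋ a′ → a ⊛ b ≋ a′ ⊛ b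
  ⊛-congʳ b a≋a′ = ⊛-cong {b = b} a≋a′ ≋-refl

  ⊛-distribˡ : ∀ a b e → a ⊛ (b ⊞ e) ≋ (a ⊛ b) ⊞ (a ⊛ e)
  ⊛-distribˡ a b e n =
    trans (Σ≤-cong n (λ l _ → trans (*-congˡ (distribˡ _ _ _)) (distribˡ _ _ _))) (Σ≤-distrib-+ n _ _)

  ⊛-distribʳ : ∀ e a b → (a ⊞ b) ⊛ e ≋ (a ⊛ e) ⊞ (b ⊛ e)
  ⊛-distribʳ e a b n =
    trans (Σ≤-cong n (λ l _ → trans (*-congˡ (distribʳ _ _ _)) (distribˡ _ _ _))) (Σ≤-distrib-+ n _ _)

  ⊛-zeroˡ : ∀ a → 𝟘 ⊛ a ≋ 𝟘
  ⊛-zeroˡ a n = Σ≤-zero n _ (λ l _ → trans (*-congˡ (zeroˡ _)) (zeroʳ _))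

  ⊛-zeroʳ : ∀ a → a ⊛ 𝟘 ≋ 𝟘
  ⊛-zeroʳ a n = Σ≤-zero n _ (λ l _ → trans (*-congˡ (zeroʳ _)) (zeroʳ _))

  ⊛-coeff₀ : ∀ a b → (a ⊛ b) 0 ≈ a 0 * b 0
  ⊛-coeff₀ a b = trans (*-congʳ (+-identityʳ 1#)) (*-identityˡ _)

  -- Pascal's rule splits each binomial coefficient of the product.
  ∂-⊛ : ∀ a b → ∂ (a ⊛ b) ≋ (∂ a ⊛ b) ⊞ (a ⊛ ∂ b)
  ∂-⊛ a b n = begin
    Σ≤ (suc n) term
      ≈⟨ Σ≤-split-head n term ⟩
    term 0 + Σ≤ n (λ l → term (suc l))
      ≈⟨ +-congˡ (Σ≤-cong n (λ l _ → pascal l)) ⟩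
    term 0 + Σ≤ n (λ l → left l + right (suc l))
      ≈⟨ +-congˡ (Σ≤-distrib-+ n left (λ l → right (suc l))) ⟩
    term 0 + (Σ≤ n left + Σ≤ n (λ l → right (suc l)))
      ≈⟨ solve 3 (λ x y z → x :+ (y :+ z) := y :+ (x :+ z)) refl (term 0) (Σ≤ n left) _ ⟩
    Σ≤ n left + (right 0 + Σ≤ n (λ l → right (suc l)))
      ≈⟨ +-congˡ (Σ≤-split-head n right) ⟨
    Σ≤ n left + Σ≤ (suc n) right
      ≈⟨ +-congˡ (trans (+-congˡ right-last≈0) (+-identityʳ _)) ⟩
    Σ≤ n left + Σ≤ n right
      ≈⟨ +-congˡ (Σ≤-cong n right-reindex) ⟩
    (∂ a ⊛ b) n + (a ⊛ ∂ b) n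
      ∎
    where
    open Solver using (solve; _:=_; _:+_)
    term left right : ℕ → Carrier
    term  l = ι (suc n C l) * (a l * b (suc n ∸ l))
    left  l = ι (n C l) * (a (suc l) * b (n ∸ l))
    right l = ι (n C l) * (a l * b (suc n ∸ l))
    pascal : ∀ l → term (suc l) ≈ left l + right (suc l)
    pascal l = begin
      ι (suc n C suc l) * abₗ
        ≡⟨ ≡.cong (λ m → ι m * abₗ) (nCk+nC[k+1]≡[n+1]C[k+1] n l) ⟨
      ι (n C l ℕ.+ n C suc l) * abₗ
        ≈⟨ *-congʳ (ι-+ (n C l) (n C suc l)) ⟩
      (ι (n C l) + ι (n C suc l)) * abₗ
        ≈⟨ distribʳ _ _ _ ⟩
      left l + right (suc l)
        ∎
      where abₗ = a (suc l) * b (n ∸ l)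
    right-last≈0 : right (suc n) ≈ 0#
    right-last≈0 = trans (*-congʳ (reflexive (≡.cong ι (k>n⇒nCk≡0 {n} ℕ.≤-refl)))) (zeroˡ _)
    right-reindex : ∀ l → l ≤ n → right l ≈ ι (n C l) * (a l * b (suc (n ∸ l)))
    right-reindex l l≤n = reflexive (≡.cong (λ m → ι (n C l) * (a l * b m)) (ℕ.+-∸-assoc 1 l≤n))

  -- A series is determined by its constant term and its derivative, so the
  -- ring laws follow by induction from the Leibniz rule.
  ⊛-identityˡ : ∀ a → one ⊛ a ≋ a
  ⊛-identityˡ a zero    = trans (⊛-coeff₀ one a) (*-identityˡ _)
  ⊛-identityˡ a (suc n) =
    trans (∂-⊛ one a n) (trans (+-cong (⊛-zeroˡ a n) (⊛-identityˡ (∂ a) n)) (+-identityˡ _))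

  ⊛-comm : ∀ a b → a ⊛ b ≋ b ⊛ a
  ⊛-comm a b zero    = *-congˡ (*-comm _ _)
  ⊛-comm a b (suc n) = begin
    (a ⊛ b) (suc n)             ≈⟨ ∂-⊛ a b n ⟩
    (∂ a ⊛ b) n + (a ⊛ ∂ b) n   ≈⟨ +-cong (⊛-comm (∂ a) b n) (⊛-comm a (∂ b) n) ⟩
    (b ⊛ ∂ a) n + (∂ b ⊛ a) n   ≈⟨ +-comm _ _ ⟩
    (∂ b ⊛ a) n + (b ⊛ ∂ a) n   ≈⟨ ∂-⊛ b a n ⟨
    (b ⊛ a) (suc n)             ∎

  ⊛-identityʳ : ∀ a → a ⊛ one ≋ a
  ⊛-identityʳ a = ≋-trans (⊛-comm a one) (⊛-identityˡ a)

  ⊛-assoc : ∀ a b e → (a ⊛ b) ⊛ e ≋ a ⊛ (b ⊛ e)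
  ⊛-assoc a b e zero = begin
    ((a ⊛ b) ⊛ e) 0      ≈⟨ trans (⊛-coeff₀ (a ⊛ b) e) (*-congʳ (⊛-coeff₀ a b)) ⟩
    (a 0 * b 0) * e 0    ≈⟨ *-assoc _ _ _ ⟩
    a 0 * (b 0 * e 0)    ≈⟨ trans (⊛-coeff₀ a (b ⊛ e)) (*-congˡ (⊛-coeff₀ b e)) ⟨
    (a ⊛ (b ⊛ e)) 0      ∎
  ⊛-assoc a b e (suc n) = begin
    ((a ⊛ b) ⊛ e) (suc n)
      ≈⟨ ∂-⊛ (a ⊛ b) e n ⟩
    (∂ (a ⊛ b) ⊛ e) n + ((a ⊛ b) ⊛ ∂ e) n
      ≈⟨ +-congʳ (trans (⊛-congʳ e (∂-⊛ a b) n) (⊛-distribʳ e (∂ a ⊛ b) (a ⊛ ∂ b) n)) ⟩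
    (((∂ a ⊛ b) ⊛ e) n + ((a ⊛ ∂ b) ⊛ e) n) + ((a ⊛ b) ⊛ ∂ e) n
      ≈⟨ +-cong (+-cong (⊛-assoc (∂ a) b e n) (⊛-assoc a (∂ b) e n)) (⊛-assoc a b (∂ e) n) ⟩
    ((∂ a ⊛ (b ⊛ e)) n + (a ⊛ (∂ b ⊛ e)) n) + (a ⊛ (b ⊛ ∂ e)) n
      ≈⟨ +-assoc _ _ _ ⟩
    (∂ a ⊛ (b ⊛ e)) n + ((a ⊛ (∂ b ⊛ e)) n + (a ⊛ (b ⊛ ∂ e)) n)
      ≈⟨ +-congˡ (trans (⊛-congˡ a (∂-⊛ b e) n) (⊛-distribˡ a (∂ b ⊛ e) (b ⊛ ∂ e) n)) ⟨
    (∂ a ⊛ (b ⊛ e)) n + (a ⊛ ∂ (b ⊛ e)) n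
      ≈⟨ ∂-⊛ a (b ⊛ e) n ⟨
    (a ⊛ (b ⊛ e)) (suc n)
      ∎

  egf-commutativeRing : CommutativeRing c ℓ
  egf-commutativeRing = record
    { Carrier = EGF ; _≈_ = _≋_ ; _+_ = _⊞_ ; _*_ = _⊛_ ; -_ = ⊟_ ; 0# = 𝟘 ; 1# = one
    ; isCommutativeRing = record
      { isRing = record
        { +-isAbelianGroup = Algebra.Construct.Pointwise.isAbelianGroup ℕ +-isAbelianGroup
        ; *-cong           = ⊛-cong
        ; *-assoc          = ⊛-assoc
        ; *-identity       = ⊛-identityˡ , ⊛-identityʳ
        ; distrib          = ⊛-distribˡ , ⊛-distribʳ
        }
      ; *-comm = ⊛-comm
      }
    }

module PowerSeriesCalculus {c ℓ : Level} (F : CharZeroField c ℓ) where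
  open CharZeroField F
  open Series F
  open CommutativeRingFacts cring
  open PowerSeriesRing F public
  open CommutativeRing egf-commutativeRing public using () renaming (setoid to ≋-setoid)
  open CommutativeRingFacts egf-commutativeRing public using ()
    renaming (+-inverseˡ-unique to ⊞-inverseˡ-unique; module Solver to ≋-Solver)

  module ≈-Reasoning = SetoidReasoning setoid
  module ≋-Reasoning = SetoidReasoning ≋-setoid

  const : Carrier → EGF
  const s zero    = s
  const s (suc n) = 0#

  t : EGF
  t zero    = 0#
  t (suc n) = one n

  const-⊛ : ∀ s a n → (const s ⊛ a) n ≈ s * a n
  const-⊛ s a zero    = ⊛-coeff₀ (const s) a
  const-⊛ s a (suc n) = begin
    (const s ⊛ a) (suc n)                     ≈⟨ ∂-⊛ (const s) a n ⟩
    (∂ (const s) ⊛ a) n + (const s ⊛ ∂ a) n   ≈⟨ +-cong (⊛-zeroˡ a n) (const-⊛ s (∂ a) n) ⟩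
    0# + s * a (suc n)                        ≈⟨ +-identityˡ _ ⟩
    s * a (suc n)                             ∎
    where open ≈-Reasoning

  const-+ : ∀ x y → const (x + y) ≋ const x ⊞ const y
  const-+ x y zero    = refl
  const-+ x y (suc n) = sym (+-identityʳ 0#)

  const-neg : ∀ s → const (- s) ≋ ⊟ const s
  const-neg s zero    = refl
  const-neg s (suc n) = sym -0#≈0#

  const-1 : const 1# ≋ one
  const-1 zero    = refl
  const-1 (suc n) = refl

  const-0 : const 0# ≋ 𝟘
  const-0 zero    = refl
  const-0 (suc n) = refl

  const-ι-suc : ∀ j → const (ι (suc j)) ≋ one ⊞ const (ι j)
  const-ι-suc j = ≋-trans (const-+ 1# (ι j)) (⊞-congʳ (const (ι j)) const-1)

  t-⊛-zero : ∀ f → (t ⊛ f) 0 ≈ 0#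
  t-⊛-zero f = trans (⊛-coeff₀ t f) (zeroˡ _)

  t-⊛-suc : ∀ f m → (t ⊛ f) (suc m) ≈ ι (suc m) * f m
  t-⊛-suc f m = begin
    (t ⊛ f) (suc m)             ≈⟨ ∂-⊛ t f m ⟩
    (one ⊛ f) m + (t ⊛ ∂ f) m   ≈⟨ +-cong (⊛-identityˡ f m) (t-⊛-∂ m) ⟩
    f m + ι m * f m             ≈⟨ +-congʳ (*-identityˡ _) ⟨
    1# * f m + ι m * f m        ≈⟨ distribʳ _ _ _ ⟨
    ι (suc m) * f m             ∎
    where
    open ≈-Reasoning
    t-⊛-∂ : ∀ m → (t ⊛ ∂ f) m ≈ ι m * f m
    t-⊛-∂ zero    = trans (t-⊛-zero (∂ f)) (sym (zeroˡ _))
    t-⊛-∂ (suc m) = t-⊛-suc (∂ f) m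

  ⊛-local : ∀ a {b b′} n → (∀ m → m ≤ n → b m ≈ b′ m) → (a ⊛ b) n ≈ (a ⊛ b′) n
  ⊛-local a n b≈b′ = Σ≤-cong n (λ l _ → *-congˡ (*-congˡ (b≈b′ (n ∸ l) (ℕ.m∸n≤m n l))))

  ⊛-*ʳ : ∀ a b s n → (a ⊛ (λ m → s * b m)) n ≈ s * (a ⊛ b) n
  ⊛-*ʳ a b s n = trans (Σ≤-cong n (λ l _ → pull-out _ _ _ _)) (sym (*-distribˡ-Σ≤ n s _))
    where
    open Solver using (solve; _:=_; _:*_)
    pull-out : ∀ w x y z → w * (x * (y * z)) ≈ y * (w * (x * z))
    pull-out = solve 4 (λ w x y z → w :* (x :* (y :* z)) := y :* (w :* (x :* z))) refl

  ⊛-Σ≤ : ∀ a N (f : ℕ → EGF) n → (a ⊛ (λ m → Σ≤ N (λ j → f j m))) n ≈ Σ≤ N (λ j → (a ⊛ f j) n)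
  ⊛-Σ≤ a zero    f n = refl
  ⊛-Σ≤ a (suc N) f n =
    trans (⊛-distribˡ a (λ m → Σ≤ N (λ j → f j m)) (f (suc N)) n) (+-congʳ (⊛-Σ≤ a N f n))

  ⊛-reindex : ∀ a b n → (a ⊛ b) n ≈ Σ≤ n (λ l → ι (n C l) * (a (n ∸ l) * b l))
  ⊛-reindex a b n = trans (⊛-comm a b n) (Σ≤-cong n (λ l _ → *-congˡ (*-comm _ _)))

  VanishesBelow : EGF → ℕ → Set ℓ
  VanishesBelow a j = ∀ m → m < j → a m ≈ 0#

  ⊛-vanishesBelow : ∀ {a b i j} → VanishesBelow a i → VanishesBelow b j → VanishesBelow (a ⊛ b) (i ℕ.+ j)
  ⊛-vanishesBelow {a} {b} {i} {j} a<i b<j n n<i+j = Σ≤-zero n _ term≈0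
    where
    term≈0 : ∀ l → l ≤ n → ι (n C l) * (a l * b (n ∸ l)) ≈ 0#
    term≈0 l l≤n with l ℕ.<? i
    ... | yes l<i = trans (*-congˡ (trans (*-congʳ (a<i l l<i)) (zeroˡ _))) (zeroʳ _)
    ... | no  l≮i = trans (*-congˡ (trans (*-congˡ (b<j (n ∸ l) n∸l<j)) (zeroʳ _))) (zeroʳ _)
      where
      n∸l<j : n ∸ l < j
      n∸l<j = ≡.subst (n ∸ l <_) (ℕ.m+n∸m≡n l j)
                (ℕ.∸-monoˡ-< (ℕ.<-≤-trans n<i+j (ℕ.+-monoˡ-≤ j (ℕ.≮⇒≥ l≮i))) l≤n)

  pow-vanishesBelow : ∀ {d} → d 0 ≈ 0# → ∀ j → VanishesBelow (pow d j) j
  pow-vanishesBelow d₀≈0 zero    m ()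
  pow-vanishesBelow d₀≈0 (suc j) = ⊛-vanishesBelow {i = 1} d<1 (pow-vanishesBelow d₀≈0 j)
    where
    d<1 : VanishesBelow _ 1
    d<1 zero    _        = d₀≈0
    d<1 (suc m) (s≤s ())

  inv1-‿inverse : ∀ d → d 0 ≈ 0# → inv1- d ⊛ (one ⊞ ⊟ d) ≋ one
  inv1-‿inverse d d₀≈0 n = begin
    (inv1- d ⊛ q) n
      ≈⟨ ⊛-comm (inv1- d) q n ⟩
    (q ⊛ inv1- d) n
      ≈⟨ ⊛-local q n inv1-‿truncate ⟩
    (q ⊛ (λ m → Σ≤ n (λ j → pow d j m))) n
      ≈⟨ ⊛-Σ≤ q n (pow d) n ⟩
    Σ≤ n (λ j → (q ⊛ pow d j) n)
      ≈⟨ Σ≤-cong n (λ j _ → q-⊛ (pow d j) n) ⟩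
    Σ≤ n (λ j → pow d j n - pow d (suc j) n)
      ≈⟨ Σ≤-telescope n (λ j → pow d j n) ⟩
    one n - pow d (suc n) n
      ≈⟨ +-congˡ (trans (-‿cong (pow-vanishesBelow d₀≈0 (suc n) n ℕ.≤-refl)) -0#≈0#) ⟩
    one n + 0#
      ≈⟨ +-identityʳ _ ⟩
    one n
      ∎
    where
    open ≈-Reasoning
    q = one ⊞ ⊟ d
    q-⊛ : ∀ p → q ⊛ p ≋ p ⊞ ⊟ (d ⊛ p)
    q-⊛ = solve 2 (λ d p → (con (+ 1) :- d) :* p := p :- d :* p) ≋-refl d
      where open ≋-Solver using (solve; _:=_; _:-_; _:*_; con)
    inv1-‿truncate : ∀ m → m ≤ n → inv1- d m ≈ Σ≤ n (λ j → pow d j m)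
    inv1-‿truncate m m≤n =
      sym (Σ≤-extend n (λ j → pow d j m) m≤n (λ j m<j _ → pow-vanishesBelow d₀≈0 j m m<j))

  ∂-pow : ∀ a j → ∂ (pow a (suc j)) ≋ const (ι (suc j)) ⊛ (∂ a ⊛ pow a j)
  ∂-pow a zero = begin
    ∂ (a ⊛ one)
      ≈⟨ ∂-⊛ a one ⟩
    (∂ a ⊛ one) ⊞ (a ⊛ 𝟘)
      ≈⟨ solve 2 (λ x a → (x :* con (+ 1)) :+ (a :* con (+ 0)) := (con (+ 1) :+ con (+ 0)) :* (x :* con (+ 1)))
                 ≋-refl (∂ a) a ⟩
    (one ⊞ 𝟘) ⊛ (∂ a ⊛ one)
      ≈⟨ ⊛-congʳ (∂ a ⊛ one) (≋-trans (const-ι-suc 0) (⊞-congˡ one const-0)) ⟨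
    const (ι 1) ⊛ (∂ a ⊛ one)
      ∎
    where
    open ≋-Reasoning
    open ≋-Solver using (solve; _:=_; _:+_; _:*_; con)
  ∂-pow a (suc j) = begin
    ∂ (a ⊛ aʲ⁺¹)
      ≈⟨ ∂-⊛ a aʲ⁺¹ ⟩
    (∂ a ⊛ aʲ⁺¹) ⊞ (a ⊛ ∂ aʲ⁺¹)
      ≈⟨ ⊞-congˡ (∂ a ⊛ aʲ⁺¹) (⊛-congˡ a (∂-pow a j)) ⟩
    (∂ a ⊛ aʲ⁺¹) ⊞ (a ⊛ (cʲ⁺¹ ⊛ (∂ a ⊛ pow a j)))
      ≈⟨ solve 4 (λ x a p m → (x :* (a :* p)) :+ (a :* (m :* (x :* p))) := (con (+ 1) :+ m) :* (x :* (a :* p)))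
                 ≋-refl (∂ a) a (pow a j) cʲ⁺¹ ⟩
    (one ⊞ cʲ⁺¹) ⊛ (∂ a ⊛ aʲ⁺¹)
      ≈⟨ ⊛-congʳ (∂ a ⊛ aʲ⁺¹) (const-ι-suc (suc j)) ⟨
    const (ι (suc (suc j))) ⊛ (∂ a ⊛ aʲ⁺¹)
      ∎
    where
    open ≋-Reasoning
    open ≋-Solver using (solve; _:=_; _:+_; _:*_; con)
    aʲ⁺¹ = pow a (suc j)
    cʲ⁺¹ = const (ι (suc j))

  ∂-inverse : ∀ {a b} → a ⊛ b ≋ one → ∂ a ≋ ⊟ ((a ⊛ a) ⊛ ∂ b)
  ∂-inverse {a} {b} a⊛b≋1 = begin
    ∂ a                 ≈⟨ ⊛-identityʳ (∂ a) ⟨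
    ∂ a ⊛ one           ≈⟨ ⊛-congˡ (∂ a) a⊛b≋1 ⟨
    ∂ a ⊛ (a ⊛ b)       ≈⟨ solve 3 (λ x a b → x :* (a :* b) := a :* (x :* b)) ≋-refl (∂ a) a b ⟩
    a ⊛ (∂ a ⊛ b)       ≈⟨ ⊛-congˡ a (⊞-inverseˡ-unique (∂ a ⊛ b) (a ⊛ ∂ b) ∂[a⊛b]≋𝟘) ⟩
    a ⊛ (⊟ (a ⊛ ∂ b))   ≈⟨ solve 2 (λ a y → a :* (:- (a :* y)) := :- ((a :* a) :* y)) ≋-refl a (∂ b) ⟩
    ⊟ ((a ⊛ a) ⊛ ∂ b)   ∎
    where
    open ≋-Reasoning
    open ≋-Solver using (solve; _:=_; _:*_; :-_)
    ∂[a⊛b]≋𝟘 : (∂ a ⊛ b) ⊞ (a ⊛ ∂ b) ≋ 𝟘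
    ∂[a⊛b]≋𝟘 n = trans (sym (∂-⊛ a b n)) (a⊛b≋1 (suc n))

  ∂-exp : ∀ x → ∂ (expS x) ≋ const x ⊛ expS x
  ∂-exp x n = sym (const-⊛ x (expS x) n)

  exp-⊛-exp-neg : ∀ x → expS x ⊛ expS (- x) ≋ one
  exp-⊛-exp-neg x zero    = trans (⊛-coeff₀ (expS x) (expS (- x))) (*-identityˡ 1#)
  exp-⊛-exp-neg x (suc n) = ∂[e⁺⊛e⁻]≋𝟘 n
    where
    open ≋-Reasoning
    open ≋-Solver using (solve; _:=_; _:+_; _:*_; :-_; con)
    e⁺ = expS x
    e⁻ = expS (- x)
    ∂[e⁺⊛e⁻]≋𝟘 : ∂ (e⁺ ⊛ e⁻) ≋ 𝟘
    ∂[e⁺⊛e⁻]≋𝟘 = begin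
      ∂ (e⁺ ⊛ e⁻)
        ≈⟨ ∂-⊛ e⁺ e⁻ ⟩
      (∂ e⁺ ⊛ e⁻) ⊞ (e⁺ ⊛ ∂ e⁻)
        ≈⟨ ⊞-cong (⊛-congʳ e⁻ (∂-exp x))
                  (⊛-congˡ e⁺ (≋-trans (∂-exp (- x)) (⊛-congʳ e⁻ (const-neg x)))) ⟩
      ((const x ⊛ e⁺) ⊛ e⁻) ⊞ (e⁺ ⊛ ((⊟ const x) ⊛ e⁻))
        ≈⟨ solve 3 (λ k a b → ((k :* a) :* b) :+ (a :* ((:- k) :* b)) := con (+ 0)) ≋-refl (const x) e⁺ e⁻ ⟩
      𝟘
        ∎

module CharZeroFieldFacts {c ℓ : Level} (F : CharZeroField c ℓ) where
  open CharZeroField F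
  open Series F
  open CommutativeRingFacts cring
  open SetoidReasoning setoid

  1#≉0# : ¬ 1# ≈ 0#
  1#≉0# 1≈0 = char-zero 0 (trans (+-identityʳ 1#) 1≈0)

  ⁻¹-unique : ∀ {x y} → ¬ x ≈ 0# → x * y ≈ 1# → y ≈ x ⁻¹
  ⁻¹-unique {x} {y} x≉0 xy≈1 = begin
    y                ≈⟨ *-identityʳ y ⟨
    y * 1#           ≈⟨ *-congˡ (⁻¹-inverse x x≉0) ⟨
    y * (x * x ⁻¹)   ≈⟨ *-assoc y x (x ⁻¹) ⟨
    (y * x) * x ⁻¹   ≈⟨ *-congʳ (trans (*-comm y x) xy≈1) ⟩
    1# * x ⁻¹        ≈⟨ *-identityˡ _ ⟩
    x ⁻¹             ∎

  *-nonzero : ∀ {x y} → ¬ x ≈ 0# → ¬ y ≈ 0# → ¬ x * y ≈ 0#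
  *-nonzero {x} {y} x≉0 y≉0 xy≈0 = y≉0 (begin
    y                ≈⟨ *-identityˡ y ⟨
    1# * y           ≈⟨ *-congʳ (trans (*-comm (x ⁻¹) x) (⁻¹-inverse x x≉0)) ⟨
    (x ⁻¹ * x) * y   ≈⟨ *-assoc _ _ _ ⟩
    x ⁻¹ * (x * y)   ≈⟨ *-congˡ xy≈0 ⟩
    x ⁻¹ * 0#        ≈⟨ zeroʳ _ ⟩
    0#               ∎)

  ^-nonzero : ∀ {x} a → ¬ x ≈ 0# → ¬ x ^ a ≈ 0#
  ^-nonzero zero    x≉0 = 1#≉0#
  ^-nonzero (suc a) x≉0 = *-nonzero x≉0 (^-nonzero a x≉0)

  ι-*-mpow : ∀ m k → ¬ ι m ≈ 0# → ι m * mpow m k ≈ mpow m (ℤ.pred k)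
  ι-*-mpow m (+ zero)  m≉0 = *-congˡ (sym (⁻¹-unique 1#≉0# (*-identityʳ 1#)))
  ι-*-mpow m (+ suc a) m≉0 = ⁻¹-unique (^-nonzero a m≉0) (begin
    ι m ^ a * (ι m * (ι m ^ suc a) ⁻¹)   ≈⟨ *-assoc _ _ _ ⟨
    (ι m ^ a * ι m) * (ι m ^ suc a) ⁻¹   ≈⟨ *-congʳ (*-comm _ _) ⟩
    ι m ^ suc a * (ι m ^ suc a) ⁻¹       ≈⟨ ⁻¹-inverse _ (^-nonzero (suc a) m≉0) ⟩
    1#                                   ∎)
  ι-*-mpow m -[1+ a ]  m≉0 = refl

  1-x≉0 : ∀ {x} → ¬ x ≈ 1# → ¬ 1# - x ≈ 0#
  1-x≉0 {x} x≉1 1-x≈0 = x≉1 (sym (begin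
    1#             ≈⟨ solve 1 (λ x → x :+ (con (+ 1) :- x) := con (+ 1)) refl x ⟨
    x + (1# - x)   ≈⟨ +-congˡ 1-x≈0 ⟩
    x + 0#         ≈⟨ +-identityʳ x ⟩
    x              ∎))
    where open Solver using (solve; _:=_; _:+_; _:-_; con)

module BernoulliAndPolylog {c ℓ : Level} (F : CharZeroField c ℓ) where
  open CharZeroField F
  open Series F
  open CommutativeRingFacts cring
  open PowerSeriesCalculus F
  open CharZeroFieldFacts F

  eᵗ-1 : EGF
  eᵗ-1 = expS 1# ⊞ ⊟ one

  eᵗ-1≋t⊛[1-bernD] : eᵗ-1 ≋ t ⊛ (one ⊞ ⊟ bernD)
  eᵗ-1≋t⊛[1-bernD] zero    = trans (-‿inverseʳ 1#) (sym (t-⊛-zero (one ⊞ ⊟ bernD)))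
  eᵗ-1≋t⊛[1-bernD] (suc m) = begin
    1# ^ suc m - 0#                  ≈⟨ trans (+-congˡ -0#≈0#) (trans (+-identityʳ _) (1#^n≈1# (suc m))) ⟩
    1#                               ≈⟨ ι[1+m]*[1-bernD]≈1 m ⟨
    ι (suc m) * (one m - bernD m)    ≈⟨ t-⊛-suc (one ⊞ ⊟ bernD) m ⟨
    (t ⊛ (one ⊞ ⊟ bernD)) (suc m)    ∎
    where
    open ≈-Reasoning
    ι[1+m]*[1-bernD]≈1 : ∀ m → ι (suc m) * (one m - bernD m) ≈ 1#
    ι[1+m]*[1-bernD]≈1 zero    =
      trans (*-cong (+-identityʳ 1#) (trans (+-congˡ -0#≈0#) (+-identityʳ 1#))) (*-identityˡ 1#)
    ι[1+m]*[1-bernD]≈1 (suc m) =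
      trans (*-congˡ (trans (+-identityˡ _) (-‿involutive _))) (⁻¹-inverse _ (char-zero (suc m)))

  B-⊛-eᵗ-1 : B ⊛ eᵗ-1 ≋ t
  B-⊛-eᵗ-1 = begin
    B ⊛ eᵗ-1                    ≈⟨ ⊛-congˡ B eᵗ-1≋t⊛[1-bernD] ⟩
    B ⊛ (t ⊛ q)                 ≈⟨ solve 3 (λ b t q → b :* (t :* q) := t :* (b :* q)) ≋-refl B t q ⟩
    t ⊛ (B ⊛ q)                 ≈⟨ ⊛-congˡ t (inv1-‿inverse bernD refl) ⟩
    t ⊛ one                     ≈⟨ ⊛-identityʳ t ⟩
    t                           ∎
    where
    open ≋-Reasoning
    open ≋-Solver using (solve; _:=_; _:*_)
    q = one ⊞ ⊟ bernD

  Σ≤-B-split : ∀ (g : EGF) m → let N = suc (suc m) in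
    Σ≤ N (λ l → ι (N C l) * (B (N ∸ l) * g l))
    ≈ (Σ≤ m (λ l → ι (N C l) * (B (N ∸ l) * g l)) + ι N * (- (ι 2 ⁻¹) * g (suc m))) + g N
  Σ≤-B-split g m = +-cong (+-congˡ second-last) last
    where
    N = suc (suc m)
    B₁ : B 1 ≈ - (ι 2 ⁻¹)
    B₁ = trans (+-identityˡ _) (⊛-identityʳ bernD 1)
    second-last : ι (N C suc m) * (B (N ∸ suc m) * g (suc m)) ≈ ι N * (- (ι 2 ⁻¹) * g (suc m))
    second-last = trans (reflexive (≡.cong₂ (λ a b → ι a * (B b * g (suc m)))
                                            ([1+n]Cn≡1+n (suc m)) (ℕ.m+n∸n≡m 1 (suc m))))
                        (*-congˡ (*-congʳ B₁))
    last : ι (N C N) * (B (N ∸ N) * g N) ≈ g N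
    last = trans (reflexive (≡.cong₂ (λ a b → ι a * (B b * g N)) (nCn≡1 N) (ℕ.n∸n≡0 N)))
                 (trans (*-congʳ (+-identityʳ 1#)) (trans (*-identityˡ _) (*-identityˡ _)))

  u : EGF
  u = oneMinusExpNeg

  u≋1-e⁻ᵗ : u ≋ one ⊞ ⊟ expS (- 1#)
  u≋1-e⁻ᵗ zero    = sym (-‿inverseʳ 1#)
  u≋1-e⁻ᵗ (suc n) = sym (+-identityˡ _)

  ∂u≋e⁻ᵗ : ∂ u ≋ expS (- 1#)
  ∂u≋e⁻ᵗ n = solve 1 (λ y → :- (:- con (+ 1) :* y) := y) refl ((- 1#) ^ n)
    where open Solver using (solve; _:=_; _:*_; :-_; con)

  eᵗ-1-⊛-∂u : eᵗ-1 ⊛ ∂ u ≋ u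
  eᵗ-1-⊛-∂u = begin
    eᵗ-1 ⊛ ∂ u             ≈⟨ ⊛-congˡ eᵗ-1 ∂u≋e⁻ᵗ ⟩
    (e⁺ ⊞ ⊟ one) ⊛ e⁻      ≈⟨ solve 2 (λ a b → (a :- con (+ 1)) :* b := (a :* b) :- b) ≋-refl e⁺ e⁻ ⟩
    (e⁺ ⊛ e⁻) ⊞ ⊟ e⁻       ≈⟨ ⊞-congʳ (⊟ e⁻) (exp-⊛-exp-neg 1#) ⟩
    one ⊞ ⊟ e⁻             ≈⟨ u≋1-e⁻ᵗ ⟨
    u                      ∎
    where
    open ≋-Reasoning
    open ≋-Solver using (solve; _:=_; _:-_; _:*_; con)
    e⁺ = expS 1#
    e⁻ = expS (- 1#)

  eᵗ-1-⊛-∂-pow : ∀ j → eᵗ-1 ⊛ ∂ (pow u j) ≋ const (ι j) ⊛ pow u j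
  eᵗ-1-⊛-∂-pow zero    = ≋-trans (⊛-zeroʳ eᵗ-1) (≋-sym (≋-trans (⊛-congʳ one const-0) (⊛-zeroˡ one)))
  eᵗ-1-⊛-∂-pow (suc j) = begin
    eᵗ-1 ⊛ ∂ (pow u (suc j))
      ≈⟨ ⊛-congˡ eᵗ-1 (∂-pow u j) ⟩
    eᵗ-1 ⊛ (cʲ⁺¹ ⊛ (∂ u ⊛ pow u j))
      ≈⟨ solve 4 (λ e m x p → e :* (m :* (x :* p)) := m :* (p :* (e :* x))) ≋-refl eᵗ-1 cʲ⁺¹ (∂ u) (pow u j) ⟩
    cʲ⁺¹ ⊛ (pow u j ⊛ (eᵗ-1 ⊛ ∂ u))
      ≈⟨ ⊛-congˡ cʲ⁺¹ (≋-trans (⊛-congˡ (pow u j) eᵗ-1-⊛-∂u) (⊛-comm (pow u j) u)) ⟩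
    cʲ⁺¹ ⊛ pow u (suc j)
      ∎
    where
    open ≋-Reasoning
    open ≋-Solver using (solve; _:=_; _:*_)
    cʲ⁺¹ = const (ι (suc j))

  liS-extend : ∀ k {n} N → n ≤ N → liS k n ≈ Σ≤ N (λ j → mpow (suc j) k * pow u j n)
  liS-extend k N n≤N =
    sym (Σ≤-extend N _ n≤N (λ j n<j _ → trans (*-congˡ (pow-vanishesBelow refl j _ n<j)) (zeroʳ _)))

  eᵗ-1-⊛-∂liS : ∀ k → (eᵗ-1 ⊛ ∂ (liS k)) ⊞ liS k ≋ liS (ℤ.pred k)
  eᵗ-1-⊛-∂liS k n = begin
    (eᵗ-1 ⊛ ∂ (liS k)) n + liS k n
      ≈⟨ +-cong euler (liS-extend k (suc n) (ℕ.n≤1+n n)) ⟩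
    Σ≤ (suc n) (λ j → mₖ j * (ι j * U j)) + Σ≤ (suc n) (λ j → mₖ j * U j)
      ≈⟨ Σ≤-distrib-+ (suc n) _ _ ⟨
    Σ≤ (suc n) (λ j → mₖ j * (ι j * U j) + mₖ j * U j)
      ≈⟨ Σ≤-cong (suc n) (λ j _ → trans (factor (mₖ j) (ι j) (U j))
                                        (*-congʳ (ι-*-mpow (suc j) k (char-zero j)))) ⟩
    Σ≤ (suc n) (λ j → mpow (suc j) (ℤ.pred k) * U j)
      ≈⟨ liS-extend (ℤ.pred k) (suc n) (ℕ.n≤1+n n) ⟨
    liS (ℤ.pred k) n
      ∎
    where
    open ≈-Reasoning
    open Solver using (solve; _:=_; _:+_; _:*_; con)
    mₖ : ℕ → Carrier
    mₖ j = mpow (suc j) k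
    U : ℕ → Carrier
    U j = pow u j n
    factor : ∀ a i y → a * (i * y) + a * y ≈ ((1# + i) * a) * y
    factor = solve 3 (λ a i y → a :* (i :* y) :+ a :* y := ((con (+ 1) :+ i) :* a) :* y) refl
    euler : (eᵗ-1 ⊛ ∂ (liS k)) n ≈ Σ≤ (suc n) (λ j → mₖ j * (ι j * U j))
    euler = begin
      (eᵗ-1 ⊛ ∂ (liS k)) n
        ≈⟨ ⊛-local eᵗ-1 n (λ m m≤n → liS-extend k (suc n) (s≤s m≤n)) ⟩
      (eᵗ-1 ⊛ (λ m → Σ≤ (suc n) (λ j → mₖ j * ∂ (pow u j) m))) n
        ≈⟨ ⊛-Σ≤ eᵗ-1 (suc n) (λ j m → mₖ j * ∂ (pow u j) m) n ⟩
      Σ≤ (suc n) (λ j → (eᵗ-1 ⊛ (λ m → mₖ j * ∂ (pow u j) m)) n)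
        ≈⟨ Σ≤-cong (suc n) (λ j _ → ⊛-*ʳ eᵗ-1 (∂ (pow u j)) (mₖ j) n) ⟩
      Σ≤ (suc n) (λ j → mₖ j * (eᵗ-1 ⊛ ∂ (pow u j)) n)
        ≈⟨ Σ≤-cong (suc n) (λ j _ → *-congˡ (trans (eᵗ-1-⊛-∂-pow j n) (const-⊛ (ι j) (pow u j) n))) ⟩
      Σ≤ (suc n) (λ j → mₖ j * (ι j * U j))
        ∎

module RationalFactor {c ℓ : Level} (F : CharZeroField c ℓ) (λ' : CharZeroField.Carrier F)
                      (λ'≉1 : ¬ CharZeroField._≈_ F λ' (CharZeroField.1# F)) where
  open CharZeroField F
  open Series F
  open CommutativeRingFacts cring
  open PowerSeriesCalculus F
  open CharZeroFieldFacts F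

  κ : Carrier
  κ = λ' * (1# - λ') ⁻¹

  H R : EGF
  H = ratH λ'
  R = inv1- (ratD λ')

  R-⊛-H : R ⊛ H ≋ one
  R-⊛-H = ≋-trans (⊛-congˡ R H≋1-d) (inv1-‿inverse (ratD λ') refl)
    where
    H≋1-d : H ≋ one ⊞ ⊟ ratD λ'
    H≋1-d zero    = sym (trans (+-congˡ -0#≈0#) (+-identityʳ 1#))
    H≋1-d (suc n) = sym (trans (+-identityˡ _) (-‿involutive _))

  ∂H : ∂ H ≋ H ⊞ const κ
  ∂H zero    = begin
    (1# - λ') ⁻¹
      ≈⟨ solve 2 (λ l y → (con (+ 1) :- l) :* y :+ l :* y := y) refl λ' ((1# - λ') ⁻¹) ⟨
    (1# - λ') * (1# - λ') ⁻¹ + κ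
      ≈⟨ +-congʳ (⁻¹-inverse _ (1-x≉0 λ'≉1)) ⟩
    1# + κ
      ∎
    where
    open ≈-Reasoning
    open Solver using (solve; _:=_; _:+_; _:-_; _:*_; con)
  ∂H (suc n) = sym (+-identityʳ _)

  ∂R : ∂ R ≋ ⊟ R ⊞ ⊟ (const κ ⊛ (R ⊛ R))
  ∂R = begin
    ∂ R
      ≈⟨ ∂-inverse {R} {H} R-⊛-H ⟩
    ⊟ ((R ⊛ R) ⊛ ∂ H)
      ≈⟨ ⊟-cong (⊛-congˡ (R ⊛ R) ∂H) ⟩
    ⊟ ((R ⊛ R) ⊛ (H ⊞ const κ))
      ≈⟨ solve 3 (λ r h k → :- ((r :* r) :* (h :+ k)) := :- ((r :* h) :* r) :+ :- (k :* (r :* r)))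
                 ≋-refl R H (const κ) ⟩
    ⊟ ((R ⊛ H) ⊛ R) ⊞ ⊟ (const κ ⊛ (R ⊛ R))
      ≈⟨ ⊞-congʳ _ (⊟-cong (≋-trans (⊛-congʳ R R-⊛-H) (⊛-identityˡ R))) ⟩
    ⊟ R ⊞ ⊟ (const κ ⊛ (R ⊛ R))
      ∎
    where
    open ≋-Reasoning
    open ≋-Solver using (solve; _:=_; _:+_; _:*_; :-_)

  ∂-pow-H : ∀ j → let ĵ = const (- ι (suc j)) in
            ∂ (pow H (suc j)) ≋ ⊟ (ĵ ⊛ pow H (suc j)) ⊞ ⊟ (const κ ⊛ (ĵ ⊛ pow H j))
  ∂-pow-H j = begin
    ∂ (pow H (suc j))
      ≈⟨ ∂-pow H j ⟩
    m ⊛ (∂ H ⊛ pow H j)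
      ≈⟨ ⊛-congˡ m (⊛-congʳ (pow H j) ∂H) ⟩
    m ⊛ ((H ⊞ const κ) ⊛ pow H j)
      ≈⟨ solve 4 (λ m h k p → m :* ((h :+ k) :* p) := :- ((:- m) :* (h :* p)) :+ :- (k :* ((:- m) :* p)))
                 ≋-refl m H (const κ) (pow H j) ⟩
    ⊟ ((⊟ m) ⊛ pow H (suc j)) ⊞ ⊟ (const κ ⊛ ((⊟ m) ⊛ pow H j))
      ≈⟨ ⊞-cong (⊟-cong (⊛-congʳ (pow H (suc j)) -m≋ĵ))
                (⊟-cong (⊛-congˡ (const κ) (⊛-congʳ (pow H j) -m≋ĵ))) ⟩
    ⊟ (ĵ ⊛ pow H (suc j)) ⊞ ⊟ (const κ ⊛ (ĵ ⊛ pow H j))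
      ∎
    where
    open ≋-Reasoning
    open ≋-Solver using (solve; _:=_; _:+_; _:*_; :-_)
    m = const (ι (suc j))
    ĵ = const (- ι (suc j))
    -m≋ĵ : ⊟ m ≋ ĵ
    -m≋ĵ = ≋-sym (const-neg (ι (suc j)))

  ∂-ratPow : ∀ r → let r̂ = const (ιℤ r) in
             ∂ (ratPow λ' r) ≋ ⊟ (r̂ ⊛ ratPow λ' r) ⊞ ⊟ (const κ ⊛ (r̂ ⊛ ratPow λ' (ℤ.suc r)))
  ∂-ratPow (+ zero)     = ≋-sym (begin
    ⊟ (const 0# ⊛ one) ⊞ ⊟ (const κ ⊛ (const 0# ⊛ pow R 1))
      ≈⟨ ⊞-cong (⊟-cong (⊛-congʳ one const-0))
                (⊟-cong (⊛-congˡ (const κ) (⊛-congʳ (pow R 1) const-0))) ⟩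
    ⊟ (𝟘 ⊛ one) ⊞ ⊟ (const κ ⊛ (𝟘 ⊛ pow R 1))
      ≈⟨ solve 2 (λ k r → :- (con (+ 0) :* con (+ 1)) :+ :- (k :* (con (+ 0) :* r)) := con (+ 0))
                 ≋-refl (const κ) (pow R 1) ⟩
    𝟘
      ∎)
    where
    open ≋-Reasoning
    open ≋-Solver using (solve; _:=_; _:+_; _:*_; :-_; con)
  ∂-ratPow (+ suc j)    = begin
    ∂ (pow R (suc j))
      ≈⟨ ∂-pow R j ⟩
    m ⊛ (∂ R ⊛ pow R j)
      ≈⟨ ⊛-congˡ m (⊛-congʳ (pow R j) ∂R) ⟩
    m ⊛ ((⊟ R ⊞ ⊟ (const κ ⊛ (R ⊛ R))) ⊛ pow R j)
      ≈⟨ solve 4 (λ m r k p → m :* (((:- r) :+ (:- (k :* (r :* r)))) :* p)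
                              := :- (m :* (r :* p)) :+ :- (k :* (m :* (r :* (r :* p)))))
                 ≋-refl m R (const κ) (pow R j) ⟩
    ⊟ (m ⊛ pow R (suc j)) ⊞ ⊟ (const κ ⊛ (m ⊛ pow R (suc (suc j))))
      ∎
    where
    open ≋-Reasoning
    open ≋-Solver using (solve; _:=_; _:+_; _:*_; :-_)
    m = const (ι (suc j))
  ∂-ratPow -[1+ zero ]  = ∂-pow-H 0
  ∂-ratPow -[1+ suc j ] = ∂-pow-H (suc j)

module TSeries {c ℓ : Level} (F : CharZeroField c ℓ) (λ' : CharZeroField.Carrier F)
               (λ'≉1 : ¬ CharZeroField._≈_ F λ' (CharZeroField.1# F))
               (r k : ℤ) (x : CharZeroField.Carrier F) where
  open CharZeroField F
  open Series F
  open PowerSeriesCalculus F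
  open BernoulliAndPolylog F
  open RationalFactor F λ' λ'≉1

  P P⁺ L X : EGF
  P  = ratPow λ' r
  P⁺ = ratPow λ' (ℤ.suc r)
  L  = liS k
  X  = expS x

  r̂ x̂ κ̂ : EGF
  r̂ = const (ιℤ r)
  x̂ = const x
  κ̂ = const κ

  G G⁺ G⁻ : EGF
  G  = T r k λ' x
  G⁺ = T (ℤ.suc r) k λ' x
  G⁻ = T r (ℤ.pred k) λ' x

  Δ : EGF
  Δ = ∂ G ⊞ (((r̂ ⊞ ⊟ x̂) ⊛ G) ⊞ (κ̂ ⊛ (r̂ ⊛ G⁺)))

  -- The extra terms of Δ cancel the derivatives of the rational factor and of eˣᵗ.
  Δ≋P⊛∂L⊛X : Δ ≋ (P ⊛ ∂ L) ⊛ X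
  Δ≋P⊛∂L⊛X = begin
    ∂ G ⊞ (((r̂ ⊞ ⊟ x̂) ⊛ G) ⊞ (κ̂ ⊛ (r̂ ⊛ G⁺)))
      ≈⟨ ⊞-congʳ _ ∂G ⟩
    (((∂P ⊛ L) ⊞ (P ⊛ ∂ L)) ⊛ X ⊞ (P ⊛ L) ⊛ (x̂ ⊛ X))
      ⊞ (((r̂ ⊞ ⊟ x̂) ⊛ G) ⊞ (κ̂ ⊛ (r̂ ⊛ G⁺)))
      ≈⟨ solve 8 (λ p p⁺ l dl xx rr kk y →
                   ((((:- (rr :* p) :+ :- (kk :* (rr :* p⁺))) :* l) :+ (p :* dl)) :* xx :+ (p :* l) :* (y :* xx))
                   :+ (((rr :- y) :* ((p :* l) :* xx)) :+ (kk :* (rr :* ((p⁺ :* l) :* xx))))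
                   := (p :* dl) :* xx)
                 ≋-refl P P⁺ L (∂ L) X r̂ κ̂ x̂ ⟩
    (P ⊛ ∂ L) ⊛ X
      ∎
    where
    open ≋-Reasoning
    open ≋-Solver using (solve; _:=_; _:+_; _:-_; _:*_; :-_)
    ∂P = ⊟ (r̂ ⊛ P) ⊞ ⊟ (κ̂ ⊛ (r̂ ⊛ P⁺))
    ∂G : ∂ G ≋ ((∂P ⊛ L) ⊞ (P ⊛ ∂ L)) ⊛ X ⊞ (P ⊛ L) ⊛ (x̂ ⊛ X)
    ∂G = begin
      ∂ ((P ⊛ L) ⊛ X)
        ≈⟨ ∂-⊛ (P ⊛ L) X ⟩
      ∂ (P ⊛ L) ⊛ X ⊞ (P ⊛ L) ⊛ ∂ X
        ≈⟨ ⊞-cong (⊛-congʳ X (≋-trans (∂-⊛ P L) (⊞-congʳ (P ⊛ ∂ L) (⊛-congʳ L (∂-ratPow r)))))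
                  (⊛-congˡ (P ⊛ L) (∂-exp x)) ⟩
      ((∂P ⊛ L) ⊞ (P ⊛ ∂ L)) ⊛ X ⊞ (P ⊛ L) ⊛ (x̂ ⊛ X)
        ∎

  G⁻≋eᵗ-1⊛Δ⊞G : G⁻ ≋ (eᵗ-1 ⊛ Δ) ⊞ G
  G⁻≋eᵗ-1⊛Δ⊞G = begin
    (P ⊛ liS (ℤ.pred k)) ⊛ X
      ≈⟨ ⊛-congʳ X (⊛-congˡ P (eᵗ-1-⊛-∂liS k)) ⟨
    (P ⊛ ((eᵗ-1 ⊛ ∂ L) ⊞ L)) ⊛ X
      ≈⟨ solve 5 (λ p e dl l xx → (p :* ((e :* dl) :+ l)) :* xx := (e :* ((p :* dl) :* xx)) :+ ((p :* l) :* xx))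
                 ≋-refl P eᵗ-1 (∂ L) L X ⟩
    (eᵗ-1 ⊛ ((P ⊛ ∂ L) ⊛ X)) ⊞ G
      ≈⟨ ⊞-congʳ G (⊛-congˡ eᵗ-1 Δ≋P⊛∂L⊛X) ⟨
    (eᵗ-1 ⊛ Δ) ⊞ G
      ∎
    where
    open ≋-Reasoning
    open ≋-Solver using (solve; _:=_; _:+_; _:*_)

  B⊛G⁻≋t⊛Δ⊞B⊛G : B ⊛ G⁻ ≋ (t ⊛ Δ) ⊞ (B ⊛ G)
  B⊛G⁻≋t⊛Δ⊞B⊛G = begin
    B ⊛ G⁻                        ≈⟨ ⊛-congˡ B G⁻≋eᵗ-1⊛Δ⊞G ⟩
    B ⊛ ((eᵗ-1 ⊛ Δ) ⊞ G)          ≈⟨ solve 4 (λ b e d g → b :* ((e :* d) :+ g) := ((b :* e) :* d) :+ (b :* g))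
                                              ≋-refl B eᵗ-1 Δ G ⟩
    ((B ⊛ eᵗ-1) ⊛ Δ) ⊞ (B ⊛ G)    ≈⟨ ⊞-congʳ (B ⊛ G) (⊛-congʳ Δ B-⊛-eᵗ-1) ⟩
    (t ⊛ Δ) ⊞ (B ⊛ G)             ∎
    where
    open ≋-Reasoning
    open ≋-Solver using (solve; _:=_; _:+_; _:*_)

  Δ-coeff : ∀ n → Δ n ≈ G (suc n) + ((ιℤ r - x) * G n + κ * (ιℤ r * G⁺ n))
  Δ-coeff n = +-congˡ (+-cong r-x-term κ-term)
    where
    r-x-term : ((r̂ ⊞ ⊟ x̂) ⊛ G) n ≈ (ιℤ r - x) * G n
    r-x-term = trans (⊛-congʳ G (≋-sym (≋-trans (const-+ (ιℤ r) (- x)) (⊞-congˡ r̂ (const-neg x)))) n)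
                     (const-⊛ (ιℤ r - x) G n)
    κ-term : (κ̂ ⊛ (r̂ ⊛ G⁺)) n ≈ κ * (ιℤ r * G⁺ n)
    κ-term = trans (const-⊛ κ (r̂ ⊛ G⁺) n) (*-congˡ (const-⊛ (ιℤ r) G⁺ n))

theorem4 : ∀ {c ℓ} (F : CharZeroField c ℓ) →
    let open CharZeroField F
        open Series F
    in (λ' : Carrier) → ¬ (λ' ≈ 1#) → (r k : ℤ) (x : Carrier) (n : ℕ) → 2 ≤ n →
       ι (ℕ.suc n) * T r k λ' x n
         + ι n * (ιℤ r + - (ι 2 ⁻¹) + - x) * T r k λ' x (n ∸ 1)
         + Σ≤ (n ∸ 2) (λ l → ι (n C l) * (B (n ∸ l) * T r k λ' x l))
       ≈ - (ιℤ r * λ' * ι n * ((1# + - λ') ⁻¹)) * T (ℤ.suc r) k λ' x (n ∸ 1)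
         + Σ≤ n (λ l → ι (n C l) * (B (n ∸ l) * T r (ℤ.pred k) λ' x l))
theorem4 F λ' λ'≉1 r k x (suc (suc m)) (s≤s (s≤s z≤n)) = begin
  ι (suc N) * G N + ι N * (ιℤ r - w - x) * G (suc m) + S
    ≈⟨ solve 10 (λ n g g₁ g⁺ y ρ w l i s →
                  (con (+ 1) :+ n) :* g :+ n :* (ρ :- w :- y) :* g₁ :+ s
                  := :- (ρ :* l :* n :* i) :* g⁺
                     :+ (n :* (g :+ ((ρ :- y) :* g₁ :+ (l :* i) :* (ρ :* g⁺))) :+ ((s :+ n :* (:- w :* g₁)) :+ g)))
               refl (ι N) (G N) (G (suc m)) (G⁺ (suc m)) x (ιℤ r) w λ' ((1# - λ') ⁻¹) S ⟩
  - c₁ * G⁺ (suc m) + (ι N * (G N + ((ιℤ r - x) * G (suc m) + κ * (ιℤ r * G⁺ (suc m))))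
                       + ((S + ι N * (- w * G (suc m))) + G N))
    ≈⟨ +-congˡ (+-cong (*-congˡ (Δ-coeff (suc m))) (Σ≤-B-split G m)) ⟨
  - c₁ * G⁺ (suc m) + (ι N * Δ (suc m) + Σ≤ N (λ l → ι (N C l) * (B (N ∸ l) * G l)))
    ≈⟨ +-congˡ (+-cong (t-⊛-suc Δ (suc m)) (⊛-reindex B G N)) ⟨
  - c₁ * G⁺ (suc m) + ((t ⊛ Δ) N + (B ⊛ G) N)
    ≈⟨ +-congˡ (B⊛G⁻≋t⊛Δ⊞B⊛G N) ⟨
  - c₁ * G⁺ (suc m) + (B ⊛ G⁻) N
    ≈⟨ +-congˡ (⊛-reindex B G⁻ N) ⟩
  - c₁ * G⁺ (suc m) + Σ≤ N (λ l → ι (N C l) * (B (N ∸ l) * G⁻ l))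
    ∎
  where
  open CharZeroField F
  open Series F
  open CommutativeRingFacts.Solver cring using (solve; _:=_; _:+_; _:-_; _:*_; :-_; con)
  open PowerSeriesCalculus F using (t; t-⊛-suc; ⊛-reindex; module ≈-Reasoning)
  open ≈-Reasoning
  open BernoulliAndPolylog F using (Σ≤-B-split)
  open RationalFactor F λ' λ'≉1 using (κ)
  open TSeries F λ' λ'≉1 r k x
  N = suc (suc m)
  w = ι 2 ⁻¹
  c₁ = ιℤ r * λ' * ι N * (1# - λ') ⁻¹
  S = Σ≤ m (λ l → ι (N C l) * (B (N ∸ l) * G l))
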